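{- For any binary matrix $\mathbf{A}\in\{0,1\}^{m\times n}$ represented in Compressed Binary Matrix (CBM) format (as defined in the context), the total number of deltas, $\sum_{(y,x)\in T}\big(|\Delta^+_{x,y}|+|\Delta^-_{x,y}|\big)$, is at most the number $\mathbf{nnz}(\mathbf{A})$ of nonzero entries of $\mathbf{A}$.
   Context: Identify each row $\vec{a}_x$ ($x=1,\dots,m$) of $\mathbf{A}$ with the set of column indices of its nonzero entries, and add a virtual null row $\vec{a}_0=\emptyset$. The extended distance graph $G$ of $\mathbf{A}$ is the complete undirected weighted graph on the vertex set $\{0,1,\dots,m\}$ in which the edge $\{x,y\}$ has weight equal to the Hamming distance $|\vec{a}_x\setminus\vec{a}_y|+|\vec{a}_y\setminus\vec{a}_x|$ (so the edge $\{0,x\}$ has weight $\mathbf{nnz}(\vec{a}_x)$). The CBM format uses as chain of compression a minimum spanning tree $T$ of $G$ rooted at vertex $0$, and for each tree edge $(y,x)$ with $y$ the parent of $x$ stores the delta lists $\Delta^+_{x,y}=\vec{a}_x\setminus\vec{a}_y$ and $\Delta^-_{x,y}=\vec{a}_y\setminus\vec{a}_x$. -}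

module Defs where

open import Data.Nat using (ℕ; zero; suc; _+_; _≤_)
open import Data.Bool using (Bool)
open import Data.Fin using (Fin; zero; suc)
open import Data.Fin.Subset using (Subset; ∣_∣; _─_; ⊥)
open import Data.Vec using (tabulate; sum)
open import Data.Product using (∃)
open import Relation.Binary.PropositionalEquality using (_≡_)

BinMatrix : ℕ → ℕ → Set
BinMatrix m n = Fin m → Fin n → Bool

rowSet : ∀ {m n} → BinMatrix m n → Fin m → Subset n
rowSet A x = tabulate (A x)

-- Rows of the extended matrix: vertex 0 is the virtual null row ∅,
-- vertex (suc x) is row x of A.
extRow : ∀ {m n} → BinMatrix m n → Fin (suc m) → Subset n
extRow A zero    = ⊥
extRow A (suc x) = rowSet A x

nnz : ∀ {m n} → BinMatrix m n → ℕ
nnz {m} A = sum (tabulate (λ x → ∣ rowSet A x ∣))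

-- Delta lists for a tree edge (y , x) with y parent of x.
Δ⁺ : ∀ {m n} → BinMatrix m n → Fin (suc m) → Fin (suc m) → Subset n
Δ⁺ A x y = extRow A x ─ extRow A y

Δ⁻ : ∀ {m n} → BinMatrix m n → Fin (suc m) → Fin (suc m) → Subset n
Δ⁻ A x y = extRow A y ─ extRow A x

weight : ∀ {m n} → BinMatrix m n → Fin (suc m) → Fin (suc m) → ℕ
weight A x y = ∣ extRow A x ─ extRow A y ∣ + ∣ extRow A y ─ extRow A x ∣

-- A rooted tree on {0,…,m} with root 0 is given by a parent map
-- assigning to each non-root vertex (suc i) its parent;
-- the tree edges are {parent i , suc i}.
ParentMap : ℕ → Set
ParentMap m = Fin m → Fin (suc m)

step : ∀ {m} → ParentMap m → Fin (suc m) → Fin (suc m)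
step p zero    = zero
step p (suc i) = p i

iter : ∀ {m} → ParentMap m → ℕ → Fin (suc m) → Fin (suc m)
iter p zero    v = v
iter p (suc k) v = iter p k (step p v)

-- The parent map describes a spanning tree of the complete graph on
-- {0,…,m} rooted at 0: no cycles, i.e. every vertex reaches 0.
IsSpanningTree : ∀ {m} → ParentMap m → Set
IsSpanningTree {m} p = (v : Fin (suc m)) → ∃ λ k → iter p k v ≡ zero

treeWeight : ∀ {m n} → BinMatrix m n → ParentMap m → ℕ
treeWeight {m} A p = sum (tabulate (λ i → weight A (suc i) (p i)))

IsMST : ∀ {m n} → BinMatrix m n → ParentMap m → Set
IsMST {m} A p =
  IsSpanningTree p × ((q : ParentMap m) → IsSpanningTree q → treeWeight A p ≤ treeWeight A q)
  where open import Data.Product using (_×_)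

totalDeltas : ∀ {m n} → BinMatrix m n → ParentMap m → ℕ
totalDeltas {m} A p =
  sum (tabulate (λ i → ∣ Δ⁺ A (suc i) (p i) ∣ + ∣ Δ⁻ A (suc i) (p i) ∣))

-- The number of deltas stored along a tree is exactly its weight in G.
-- The star tree hanging every row directly off the null row costs
-- Σₓ |aₓ ─ ∅| = nnz(A), so a minimum spanning tree costs at most that.
module Submission where

open import Defs
open import Data.Nat using (ℕ; _≤_; zero; suc; _+_)
open import Data.Nat.Properties using (n≤0⇒n≡0; +-identityʳ; module ≤-Reasoning)
open import Data.Fin using (Fin; zero; suc)
open import Data.Fin.Subset using (Subset; ∣_∣; _─_; ⊥)
open import Data.Fin.Subset.Properties using (p─⊥≡p; ∣⊥∣≡0; ∣p─q∣≤∣p∣)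
open import Data.Vec using (sum)
open import Data.Vec.Properties using (tabulate-cong)
open import Data.Product using (_,_)
open import Relation.Binary.PropositionalEquality using (_≡_; refl; cong; subst; module ≡-Reasoning)

∣⊥─p∣≡0 : ∀ {n} (p : Subset n) → ∣ ⊥ ─ p ∣ ≡ 0
∣⊥─p∣≡0 {n} p = n≤0⇒n≡0 (subst (∣ ⊥ ─ p ∣ ≤_) (∣⊥∣≡0 n) (∣p─q∣≤∣p∣ ⊥ p))

weight-toRoot : ∀ {m n} (A : BinMatrix m n) (i : Fin m) → weight A (suc i) zero ≡ ∣ rowSet A i ∣
weight-toRoot A i = begin
  ∣ rowSet A i ─ ⊥ ∣ + ∣ ⊥ ─ rowSet A i ∣  ≡⟨ cong (∣ rowSet A i ─ ⊥ ∣ +_) (∣⊥─p∣≡0 (rowSet A i)) ⟩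
  ∣ rowSet A i ─ ⊥ ∣ + 0                    ≡⟨ +-identityʳ _ ⟩
  ∣ rowSet A i ─ ⊥ ∣                        ≡⟨ cong ∣_∣ (p─⊥≡p (rowSet A i)) ⟩
  ∣ rowSet A i ∣                            ∎
  where open ≡-Reasoning

star : ∀ {m} → ParentMap m
star i = zero

star-isSpanningTree : ∀ {m} → IsSpanningTree (star {m})
star-isSpanningTree zero    = 0 , refl
star-isSpanningTree (suc i) = 1 , refl

treeWeight-star : ∀ {m n} (A : BinMatrix m n) → treeWeight A star ≡ nnz A
treeWeight-star A = cong sum (tabulate-cong (weight-toRoot A))

totalDeltas≡treeWeight : ∀ {m n} (A : BinMatrix m n) (T : ParentMap m) →
  totalDeltas A T ≡ treeWeight A T
totalDeltas≡treeWeight A T = refl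

mainTheorem3 : (m n : ℕ) (A : BinMatrix m n) (T : ParentMap m) →
    IsMST A T → totalDeltas A T ≤ nnz A
mainTheorem3 m n A T (_ , minimal) = begin
  totalDeltas A T     ≡⟨ totalDeltas≡treeWeight A T ⟩
  treeWeight A T      ≤⟨ minimal star star-isSpanningTree ⟩
  treeWeight A star   ≡⟨ treeWeight-star A ⟩
  nnz A               ∎
  where open ≤-Reasoning
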